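{- Let $\mathrm{H}_2$, $\mathrm{H}_1$, $\mathrm{H}_0$ be strongly connected reflexive tournaments such that $\mathrm{H}_1$ is a subtournament of $\mathrm{H}_2$ and $\mathrm{H}_0$ is a subtournament of $\mathrm{H}_1$. Suppose that every endomorphism $e$ of $\mathrm{H}_1$ with $e(V(\mathrm{H}_0))=V(\mathrm{H}_0)$ is an automorphism. Then for every endomorphism $h$ of $\mathrm{H}_2$ whose restriction to $\mathrm{H}_0$ is an isomorphism onto an induced subgraph of $\mathrm{H}_2$, the restriction of $h$ to $\mathrm{H}_1$ is an isomorphism onto the induced subgraph $h(\mathrm{H}_1)$ of $\mathrm{H}_2$.
   Context: A reflexive tournament is a digraph with more than one vertex, a loop at every vertex, and exactly one of $(u,v),(v,u)$ as an edge for every two distinct vertices; a subtournament is an induced subgraph that is a tournament. Strongly connected means there is a directed path between any ordered pair of vertices. An endomorphism is a homomorphism (edge-preserving vertex map) from a digraph to itself; an automorphism is a bijective endomorphism whose inverse is a homomorphism. -}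

module Defs where

open import Data.Nat using (ℕ)
open import Data.Bool using (Bool; T)
open import Data.Fin using (Fin)
open import Data.Product using (Σ; ∃; ∃₂; _×_; _,_; proj₁)
open import Data.Sum using (_⊎_)
open import Relation.Nullary using (¬_)
open import Relation.Binary.PropositionalEquality using (_≡_; _≢_)
open import Function.Definitions using (Injective)

record Digraph : Set₁ where
  constructor mkDigraph
  field
    V : Set
    E : V → V → Set
open Digraph public

FinDigraph : (n : ℕ) → (Fin n → Fin n → Set) → Digraph
FinDigraph n E = mkDigraph (Fin n) E

Induced : (G : Digraph) → (V G → Bool) → Digraph
Induced G P = mkDigraph (Σ (V G) (λ v → T (P v)))
                        (λ u v → E G (proj₁ u) (proj₁ v))

IsHom : (G H : Digraph) → (V G → V H) → Set
IsHom G H f = ∀ u v → E G u v → E H (f u) (f v)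

IsEndomorphism : (G : Digraph) → (V G → V G) → Set
IsEndomorphism G f = IsHom G G f

IsAutomorphism : (G : Digraph) → (V G → V G) → Set
IsAutomorphism G f =
  IsEndomorphism G f ×
  Σ (V G → V G) (λ g →
    (∀ x → g (f x) ≡ x) × (∀ y → f (g y) ≡ y) × IsHom G G g)

IsReflexiveTournament : Digraph → Set
IsReflexiveTournament G =
  (∃₂ λ (u v : V G) → u ≢ v) ×
  (∀ v → E G v v) ×
  (∀ u v → u ≢ v → (E G u v × ¬ E G v u) ⊎ (E G v u × ¬ E G u v))

data Reach (G : Digraph) : V G → V G → Set where
  here : ∀ {v} → Reach G v v
  step : ∀ {u v w} → E G u v → Reach G v w → Reach G u w

StronglyConnected : Digraph → Set
StronglyConnected G = ∀ u v → Reach G u v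

-- f : G → H is an isomorphism of G onto the induced subgraph f(G) of H:
-- f is an injective homomorphism which also reflects edges
-- (so it is a bijection V(G) → f(V(G)) with inverse a homomorphism of the
-- induced subgraph on f(V(G)) into G).
IsIsoOntoInducedImage : (G H : Digraph) → (V G → V H) → Set
IsIsoOntoInducedImage G H f =
  IsHom G H f × Injective _≡_ _≡_ f × (∀ u v → E H (f u) (f v) → E G u v)

-- Send each vertex x of H₁ to a fixed representative of its h-fibre in H₁,
-- chosen in H₀ whenever the fibre meets H₀. Because H₂ has no 2-cycles, this
-- retraction is an endomorphism of H₁; since h is injective on H₀ it fixes
-- H₀ pointwise, so by hypothesis it is an automorphism. It is constant on
-- h-fibres, so h is injective on H₁, and an injective homomorphism between
-- reflexive tournaments reflects edges.
module Submission where

open import Defs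
open import Data.Nat using (ℕ)
open import Data.Bool using (Bool; T)
open import Data.Bool.Properties using (T-irrelevant)
open import Data.Fin using (Fin; _≟_)
open import Data.Fin.Properties using (any?)
open import Data.Product using (Σ; ∃; _×_; _,_; proj₁; proj₂)
open import Data.Product.Properties using (Σ-≡,≡→≡)
open import Data.Sum using (inj₁; inj₂)
open import Data.Empty using (⊥; ⊥-elim)
open import Relation.Nullary using (Dec; yes; no)
open import Relation.Nullary.Decidable using (T?; _×-dec_)
open import Relation.Binary.Definitions using (DecidableEquality)
open import Relation.Binary.PropositionalEquality
  using (_≡_; _≢_; refl; sym; trans; cong; subst; subst₂; module ≡-Reasoning)
open import Function.Definitions using (Injective)

module _ {G H : Digraph} where

  tournament-no-2-cycle : IsReflexiveTournament H →
    ∀ {a b} → a ≢ b → E H a b → E H b a → ⊥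
  tournament-no-2-cycle (_ , _ , tour) {a} {b} a≢b ab ba with tour a b a≢b
  ... | inj₁ (_ , ¬ba) = ¬ba ba
  ... | inj₂ (_ , ¬ab) = ¬ab ab

  loop-at-equal : IsReflexiveTournament G → ∀ {u v} → u ≡ v → E G u v
  loop-at-equal (_ , loop , _) {u} refl = loop u

  -- Any map e constant on f-fibres with f ∘ e = f is an endomorphism: an edge
  -- e v → e u would map to f v → f u, a 2-cycle in H.
  fibrewise-retraction-isEndomorphism :
    IsReflexiveTournament G → IsReflexiveTournament H → DecidableEquality (V H) →
    (f : V G → V H) → IsHom G H f →
    (e : V G → V G) → (∀ x → f (e x) ≡ f x) → (∀ x y → f x ≡ f y → e x ≡ e y) →
    IsEndomorphism G e
  fibrewise-retraction-isEndomorphism G-tour H-tour _≟H_ f f-hom e f∘e≗f e-fibrewise u v uv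
    with f u ≟H f v
  ... | yes fu≡fv = loop-at-equal G-tour (e-fibrewise u v fu≡fv)
  ... | no fu≢fv with proj₂ (proj₂ G-tour) (e u) (e v) eu≢ev
    where
    eu≢ev : e u ≢ e v
    eu≢ev eu≡ev = fu≢fv (trans (sym (f∘e≗f u)) (trans (cong f eu≡ev) (f∘e≗f v)))
  ...   | inj₁ (eu→ev , _) = eu→ev
  ...   | inj₂ (ev→eu , _) = ⊥-elim (tournament-no-2-cycle H-tour fu≢fv (f-hom u v uv) fv→fu)
    where
    fv→fu : E H (f v) (f u)
    fv→fu = subst₂ (E H) (f∘e≗f v) (f∘e≗f u) (f-hom (e v) (e u) ev→eu)

  injective-hom-reflects-edges :
    IsReflexiveTournament G → IsReflexiveTournament H → DecidableEquality (V H) →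
    (f : V G → V H) → IsHom G H f → Injective _≡_ _≡_ f →
    ∀ u v → E H (f u) (f v) → E G u v
  injective-hom-reflects-edges G-tour H-tour _≟H_ f f-hom f-inj u v fu→fv with f u ≟H f v
  ... | yes fu≡fv = loop-at-equal G-tour (f-inj fu≡fv)
  ... | no fu≢fv with proj₂ (proj₂ G-tour) u v (λ u≡v → fu≢fv (cong f u≡v))
  ...   | inj₁ (u→v , _) = u→v
  ...   | inj₂ (v→u , _) = ⊥-elim (tournament-no-2-cycle H-tour fu≢fv fu→fv (f-hom v u v→u))

Subset : ℕ → Set
Subset n = Fin n → Bool

Member : ∀ {n} → Subset n → Set
Member {n} P = Σ (Fin n) (λ v → T (P v))

member-ext : ∀ {n} {P : Subset n} {x y : Member P} → proj₁ x ≡ proj₁ y → x ≡ y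
member-ext eq = Σ-≡,≡→≡ (eq , T-irrelevant _ _)

module FibreRetraction {n} (P₁ P₀ : Subset n) (P₀⊆P₁ : ∀ v → T (P₀ v) → T (P₁ v))
                       (h : Fin n → Fin n) where

  preimage? : (P : Subset n) (z : Fin n) → Dec (∃ λ i → T (P i) × h i ≡ z)
  preimage? P z = any? (λ i → T? (P i) ×-dec (h i ≟ z))

  -- The default x is returned only when z has no preimage in P₁ at all.
  representative : Fin n → Member P₁ → Member P₁
  representative z x with preimage? P₀ z | preimage? P₁ z
  ... | yes (i , i∈P₀ , _) | _ = i , P₀⊆P₁ i i∈P₀
  ... | no _ | yes (i , i∈P₁ , _) = i , i∈P₁
  ... | no _ | no _ = x

  retraction : Member P₁ → Member P₁
  retraction x = representative (h (proj₁ x)) x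

  h-representative : ∀ z x → h (proj₁ x) ≡ z → h (proj₁ (representative z x)) ≡ z
  h-representative z x hx≡z with preimage? P₀ z | preimage? P₁ z
  ... | yes (_ , _ , hi≡z) | _ = hi≡z
  ... | no _ | yes (_ , _ , hi≡z) = hi≡z
  ... | no _ | no _ = hx≡z

  representative-default-irrelevant : ∀ z x y → h (proj₁ x) ≡ z →
    representative z x ≡ representative z y
  representative-default-irrelevant z x y hx≡z with preimage? P₀ z | preimage? P₁ z
  ... | yes _ | _ = refl
  ... | no _ | yes _ = refl
  ... | no _ | no ∄ = ⊥-elim (∄ (proj₁ x , proj₂ x , hx≡z))

  representative-of-P₀ : Injective _≡_ _≡_ (λ (x : Member P₀) → h (proj₁ x)) →
    ∀ z x → T (P₀ (proj₁ x)) → h (proj₁ x) ≡ z → representative z x ≡ x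
  representative-of-P₀ h-inj₀ z (x , _) x∈P₀ hx≡z with preimage? P₀ z | preimage? P₁ z
  ... | yes (i , i∈P₀ , hi≡z) | _ =
    member-ext (cong proj₁ (h-inj₀ {i , i∈P₀} {x , x∈P₀} (trans hi≡z (sym hx≡z))))
  ... | no ∄ | _ = ⊥-elim (∄ (x , x∈P₀ , hx≡z))

  h-retraction : ∀ x → h (proj₁ (retraction x)) ≡ h (proj₁ x)
  h-retraction x = h-representative (h (proj₁ x)) x refl

  retraction-fibrewise : ∀ x y → h (proj₁ x) ≡ h (proj₁ y) → retraction x ≡ retraction y
  retraction-fibrewise x y hx≡hy = begin
    representative (h (proj₁ x)) x ≡⟨ representative-default-irrelevant _ x y refl ⟩
    representative (h (proj₁ x)) y ≡⟨ cong (λ z → representative z y) hx≡hy ⟩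
    representative (h (proj₁ y)) y ∎
    where open ≡-Reasoning

  retraction-fixes-P₀ : Injective _≡_ _≡_ (λ (x : Member P₀) → h (proj₁ x)) →
    ∀ x → T (P₀ (proj₁ x)) → retraction x ≡ x
  retraction-fixes-P₀ h-inj₀ x x∈P₀ = representative-of-P₀ h-inj₀ _ x x∈P₀ refl

lemma19 : (n : ℕ) (E : Fin n → Fin n → Set) (P₁ P₀ : Fin n → Bool) →
    (∀ v → T (P₀ v) → T (P₁ v)) →
    IsReflexiveTournament (FinDigraph n E) →
    StronglyConnected (FinDigraph n E) →
    IsReflexiveTournament (Induced (FinDigraph n E) P₁) →
    StronglyConnected (Induced (FinDigraph n E) P₁) →
    IsReflexiveTournament (Induced (FinDigraph n E) P₀) →
    StronglyConnected (Induced (FinDigraph n E) P₀) →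
    ((e : V (Induced (FinDigraph n E) P₁) → V (Induced (FinDigraph n E) P₁)) →
      IsEndomorphism (Induced (FinDigraph n E) P₁) e →
      (∀ x → T (P₀ (proj₁ x)) → T (P₀ (proj₁ (e x)))) →
      (∀ y → T (P₀ (proj₁ y)) → Σ (V (Induced (FinDigraph n E) P₁)) (λ x → T (P₀ (proj₁ x)) × e x ≡ y)) →
      IsAutomorphism (Induced (FinDigraph n E) P₁) e) →
    (h : Fin n → Fin n) →
    IsEndomorphism (FinDigraph n E) h →
    IsIsoOntoInducedImage (Induced (FinDigraph n E) P₀) (FinDigraph n E) (λ x → h (proj₁ x)) →
    IsIsoOntoInducedImage (Induced (FinDigraph n E) P₁) (FinDigraph n E) (λ x → h (proj₁ x))
lemma19 n E P₁ P₀ P₀⊆P₁ H₂-tour _ H₁-tour _ _ _ rigid h h-hom (_ , h-inj₀ , _) =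
  h₁-hom , h₁-inj , injective-hom-reflects-edges H₁-tour H₂-tour _≟_ h₁ h₁-hom h₁-inj
  where
  open FibreRetraction P₁ P₀ P₀⊆P₁ h

  h₁ : Member P₁ → Fin n
  h₁ x = h (proj₁ x)

  h₁-hom : IsHom (Induced (FinDigraph n E) P₁) (FinDigraph n E) h₁
  h₁-hom u v = h-hom (proj₁ u) (proj₁ v)

  fixes-P₀ : ∀ x → T (P₀ (proj₁ x)) → retraction x ≡ x
  fixes-P₀ = retraction-fixes-P₀ h-inj₀

  retraction-aut : IsAutomorphism (Induced (FinDigraph n E) P₁) retraction
  retraction-aut = rigid retraction
    (fibrewise-retraction-isEndomorphism H₁-tour H₂-tour _≟_ h₁ h₁-hom
      retraction h-retraction retraction-fibrewise)
    (λ x x∈P₀ → subst (λ y → T (P₀ (proj₁ y))) (sym (fixes-P₀ x x∈P₀)) x∈P₀)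
    (λ y y∈P₀ → y , y∈P₀ , fixes-P₀ y y∈P₀)

  h₁-inj : Injective _≡_ _≡_ h₁
  h₁-inj {x} {y} hx≡hy = begin
    x                     ≡⟨ sym (left-inverse x) ⟩
    g (retraction x)      ≡⟨ cong g (retraction-fibrewise x y hx≡hy) ⟩
    g (retraction y)      ≡⟨ left-inverse y ⟩
    y                     ∎
    where
    open ≡-Reasoning
    g : Member P₁ → Member P₁
    g = proj₁ (proj₂ retraction-aut)
    left-inverse : ∀ x → g (retraction x) ≡ x
    left-inverse = proj₁ (proj₂ (proj₂ retraction-aut))
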